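{- Let $N = q^k n^2$ be an odd perfect number, where $q$ is a prime with $q \equiv k \equiv 1 \pmod 4$ and $\gcd(q,n)=1$. If $I(n^2) \geq 2 - \frac{5}{3q}$, then $k=1$ and $q=5$.
   Context: For a positive integer $N$, $\sigma(N)$ denotes the sum of the positive divisors of $N$; $N$ is perfect if $\sigma(N)=2N$. The abundancy index of a positive integer $w$ is $I(w)=\sigma(w)/w$. -}

module Defs where

open import Data.Nat using (ℕ; zero; suc; _*_; _<_)
open import Data.Nat.Divisibility using (_∣?_)
open import Data.Nat.ListAction using (sum)
open import Data.List using (filter; map; upTo)
open import Data.Product using (_×_)
open import Relation.Binary.PropositionalEquality using (_≡_)
open import Data.Integer using (+_)
open import Data.Rational.Unnormalised using (ℚᵘ; _/_; 0ℚᵘ)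

σ : ℕ → ℕ
σ N = sum (filter (_∣? N) (map suc (upTo N)))

Perfect : ℕ → Set
Perfect N = (0 < N) × (σ N ≡ 2 * N)

-- Abundancy index I(w) = σ(w)/w for positive w (value at 0 is a dummy 0).
I : ℕ → ℚᵘ
I zero    = 0ℚᵘ
I (suc m) = (+ σ (suc m)) / suc m

-- The rational 5/(3q) for positive q (dummy 0 at q = 0).
five/3q : ℕ → ℚᵘ
five/3q zero    = 0ℚᵘ
five/3q (suc m) = (+ 5) / (3 * suc m)

module Submission where

-- Let N = q^k n² be perfect with q prime, q ≡ k ≡ 1 (mod 4) and gcd(q, n) = 1,
-- and write P = n², S = σ(n²).  The proof only uses two inequalities.
--
--  (H) Clearing denominators in 2 - 5/(3q) ≤ S/P gives 6qP ≤ 3qS + 5P.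
--  (σ) Since q^k and n² are coprime, σ(q^k) σ(n²) ≤ σ(q^k n²) = 2 q^k n²;
--      the products of a divisor of q^k and a divisor of n² are distinct
--      divisors of N.  Moreover σ(q) ≥ 1 + q and σ(q^(j+2)) ≥ q^j (1 + q + q²).
--
-- Multiplying (H) by c and inserting a bound c S ≤ 2 q^k P eliminates S and
-- leaves an inequality in q alone: for k = 1 (c = 1 + q) it says q ≤ 5, hence
-- q = 5 as q ≡ 1 (mod 4); for k ≥ 2 (c = q^(k-2)(1 + q + q²)) it says
-- q + q² ≤ 5, which is impossible for q ≥ 2.  As k ≡ 1 (mod 4) excludes k = 0,
-- this proves k = 1 and q = 5.

open import Defs
open import Data.Nat using (ℕ; _^_; _*_; _%_)
open import Data.Nat.Primality using (Prime)
open import Data.Nat.Coprimality using (Coprime)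
open import Data.Product using (_×_)
open import Relation.Binary.PropositionalEquality using (_≡_)

open import Data.Nat using (zero; suc; _+_; NonZero; >-nonZero; nonTrivial⇒n>1)
open import Data.Nat.Primality using (prime⇒nonTrivial; prime⇒nonZero)
open import Data.Product using (_,_)
open import Data.Empty using (⊥; ⊥-elim)

module DivisorSums where

  open import Data.Nat using (_∸_; _≤_; _<_; z≤n; s≤s⁻¹)
  open import Data.Nat.Properties
  open import Algebra.Properties.CommutativeSemigroup +-commutativeSemigroup using (x∙yz≈y∙xz)
  open import Data.Nat.Divisibility
    using (_∣_; _∣?_; divides; ∣-refl; ∣-trans; ∣-antisym; ∣⇒≤; 0∣⇒≡0; ∣1⇒≡1; *-monoʳ-∣; *-pres-∣; m∣m*n; n∣m*n)
  import Data.Nat.Coprimality as Coprimality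
  open import Data.Nat.ListAction using (sum)
  open import Data.Nat.ListAction.Properties using (sum-++)
  open import Data.Nat.Tactic.RingSolver using (solve)
  open import Data.List using (List; []; _∷_; _++_; map; filter; upTo; cartesianProductWith)
  open import Data.List.Membership.Propositional using (_∈_)
  open import Data.List.Membership.Propositional.Properties
    using (∈-∃++; ∈-++⁻; ∈-++⁺ˡ; ∈-++⁺ʳ; ∈-map⁻; ∈-map⁺; ∈-filter⁻; ∈-filter⁺; ∈-upTo⁺; ∈-upTo⁻; ∈-cartesianProductWith⁻)
  open import Data.List.Relation.Unary.Any using (here; there)
  import Data.List.Relation.Unary.All as All
  import Data.List.Relation.Unary.All.Properties as All
  open import Data.List.Relation.Unary.Unique.Propositional using (Unique; []; _∷_)
  open import Data.List.Relation.Unary.Unique.Propositional.Properties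
    using (map⁺; filter⁺; upTo⁺; ++⁺; Unique[x∷xs]⇒x∉xs)
  open import Data.List.Relation.Binary.Disjoint.Propositional using (Disjoint)
  open import Data.List.Relation.Binary.Subset.Propositional using (_⊆_)
  open import Data.Sum using (inj₁; inj₂)
  open import Data.Product using (proj₁; proj₂)
  open import Function using (_∘_)
  open import Relation.Binary.PropositionalEquality using (refl; sym; trans; cong; cong₂; subst)
  open import Relation.Binary.Definitions using (tri<; tri≈; tri>)
  open import Relation.Nullary using (contradiction)
  open ≤-Reasoning

  divisors : ℕ → List ℕ
  divisors N = filter (_∣? N) (map suc (upTo N))

  divisors-unique : ∀ N → Unique (divisors N)
  divisors-unique N = filter⁺ (_∣? N) (map⁺ suc-injective (upTo⁺ N))

  ∈-divisors⁻ : ∀ N {x} → x ∈ divisors N → x ∣ N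
  ∈-divisors⁻ N = proj₂ ∘ ∈-filter⁻ (_∣? N) {xs = map suc (upTo N)}

  ∈-divisors⁺ : ∀ {N x} .{{_ : NonZero N}} → x ∣ N → x ∈ divisors N
  ∈-divisors⁺ {suc _} {zero} 0∣N with () ← 0∣⇒≡0 0∣N
  ∈-divisors⁺ {suc N} {suc x} x∣N = ∈-filter⁺ (_∣? suc N) (∈-map⁺ suc (∈-upTo⁺ (∣⇒≤ x∣N))) x∣N

  sum-⊆ : ∀ {xs ys} → Unique xs → xs ⊆ ys → sum xs ≤ sum ys
  sum-⊆ [] _ = z≤n
  sum-⊆ {x ∷ xs} (x≢xs ∷ xs!) xs⊆ys with us , vs , refl ← ∈-∃++ (xs⊆ys (here refl)) = begin
    x + sum xs                ≤⟨ +-monoʳ-≤ x (sum-⊆ xs! xs⊆us++vs) ⟩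
    x + sum (us ++ vs)        ≡⟨ cong (x +_) (sum-++ us vs) ⟩
    x + (sum us + sum vs)     ≡⟨ x∙yz≈y∙xz x (sum us) (sum vs) ⟩
    sum us + (x + sum vs)     ≡⟨ sum-++ us (x ∷ vs) ⟨
    sum (us ++ x ∷ vs)        ∎
    where
    -- every element of xs differs from x, so it survives deleting x from us ++ x ∷ vs
    xs⊆us++vs : xs ⊆ us ++ vs
    xs⊆us++vs {v} v∈xs with ∈-++⁻ us (xs⊆ys (there v∈xs))
    ... | inj₁ v∈us          = ∈-++⁺ˡ v∈us
    ... | inj₂ (there v∈vs)  = ∈-++⁺ʳ us v∈vs
    ... | inj₂ (here refl)   = contradiction v∈xs (Unique[x∷xs]⇒x∉xs (x≢xs ∷ xs!))

  divisor-sum-bound : ∀ {N} .{{_ : NonZero N}} {xs} → Unique xs → (∀ {v} → v ∈ xs → v ∣ N) → sum xs ≤ σ N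
  divisor-sum-bound xs! xs∣N = sum-⊆ xs! (∈-divisors⁺ ∘ xs∣N)

  sum-map-* : ∀ c xs → sum (map (c *_) xs) ≡ c * sum xs
  sum-map-* c []       = sym (*-zeroʳ c)
  sum-map-* c (x ∷ xs) = begin-equality
    c * x + sum (map (c *_) xs)  ≡⟨ cong (c * x +_) (sum-map-* c xs) ⟩
    c * x + c * sum xs           ≡⟨ *-distribˡ-+ c x (sum xs) ⟨
    c * (x + sum xs)             ∎

  sum-products : ∀ xs ys → sum (cartesianProductWith _*_ xs ys) ≡ sum xs * sum ys
  sum-products []       ys = refl
  sum-products (x ∷ xs) ys = begin-equality
    sum (map (x *_) ys ++ cartesianProductWith _*_ xs ys)          ≡⟨ sum-++ (map (x *_) ys) _ ⟩
    sum (map (x *_) ys) + sum (cartesianProductWith _*_ xs ys)    ≡⟨ cong₂ _+_ (sum-map-* x ys) (sum-products xs ys) ⟩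
    x * sum ys + sum xs * sum ys                                  ≡⟨ *-distribʳ-+ (sum ys) x (sum xs) ⟨
    (x + sum xs) * sum ys                                         ∎

  -- Variants of the library's map⁺ and cartesianProductWith⁺ that need injectivity only on
  -- the members of the lists: multiplication is injective on pairs of divisors of coprime
  -- numbers (coprime-product-injective), but not globally.
  map-unique : ∀ {A B : Set} {f : A → B} {xs} → (∀ {x y} → x ∈ xs → y ∈ xs → f x ≡ f y → x ≡ y) →
               Unique xs → Unique (map f xs)
  map-unique f-inj []            = []
  map-unique f-inj (x≢xs ∷ xs!) =
    All.map⁺ (All.tabulate λ y∈xs fx≡fy → All.lookup x≢xs y∈xs (f-inj (here refl) (there y∈xs) fx≡fy))
    ∷ map-unique (λ x∈ y∈ → f-inj (there x∈) (there y∈)) xs!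

  products-unique : ∀ {A B C : Set} (f : A → B → C) {xs ys} →
    (∀ {a a′ b b′} → a ∈ xs → a′ ∈ xs → b ∈ ys → b′ ∈ ys → f a b ≡ f a′ b′ → a ≡ a′ × b ≡ b′) →
    Unique xs → Unique ys → Unique (cartesianProductWith f xs ys)
  products-unique f             f-inj []            ys! = []
  products-unique f {x ∷ xs} {ys} f-inj (x≢xs ∷ xs!) ys! =
    ++⁺ (map-unique (λ b∈ b′∈ → proj₂ ∘ f-inj (here refl) (here refl) b∈ b′∈) ys!)
        (products-unique f (λ a∈ a′∈ → f-inj (there a∈) (there a′∈)) xs! ys!)
        row-disjoint
    where
    -- the values f x b are distinct from the values f a b′ with a ∈ xs, since x ∉ xs
    row-disjoint : Disjoint (map (f x) ys) (cartesianProductWith f xs ys)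
    row-disjoint (v∈row , v∈rest)
      with b , b∈ys , refl ← ∈-map⁻ (f x) v∈row
         | a , b′ , a∈xs , b′∈ys , fxb≡fab′ ← ∈-cartesianProductWith⁻ f xs ys v∈rest
      = All.lookup x≢xs a∈xs (proj₁ (f-inj (here refl) (there a∈xs) b∈ys b′∈ys fxb≡fab′))

  coprime-divisors : ∀ {m n a b} → Coprime m n → a ∣ m → b ∣ n → Coprime a b
  coprime-divisors m⊥n a∣m b∣n (d∣a , d∣b) = m⊥n (∣-trans d∣a a∣m , ∣-trans d∣b b∣n)

  coprime-cancel : ∀ {m n x y z} → Coprime m n → x ∣ m → y ∣ n → x ∣ y * z → x ∣ z
  coprime-cancel m⊥n x∣m y∣n = Coprimality.coprime-divisor (coprime-divisors m⊥n x∣m y∣n)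

  coprime-product-injective : ∀ {m n a a′ b b′} → Coprime m n → a ∣ m → a′ ∣ m → b ∣ n → b′ ∣ n →
                              a * b ≡ a′ * b′ → a ≡ a′ × b ≡ b′
  coprime-product-injective {m} {n} {a} {a′} {b} {b′} m⊥n a∣m a′∣m b∣n b′∣n ab≡a′b′ =
    ∣-antisym (coprime-cancel m⊥n a∣m b′∣n a∣b′a′) (coprime-cancel m⊥n a′∣m b∣n a′∣ba) ,
    ∣-antisym (coprime-cancel n⊥m b∣n a′∣m b∣a′b′) (coprime-cancel n⊥m b′∣n a∣m b′∣ab)
    where
    n⊥m : Coprime n m
    n⊥m = Coprimality.sym m⊥n
    a∣b′a′ : a ∣ b′ * a′
    a∣b′a′ = subst (a ∣_) (trans ab≡a′b′ (*-comm a′ b′)) (m∣m*n b)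
    a′∣ba : a′ ∣ b * a
    a′∣ba = subst (a′ ∣_) (trans (sym ab≡a′b′) (*-comm a b)) (m∣m*n b′)
    b∣a′b′ : b ∣ a′ * b′
    b∣a′b′ = subst (b ∣_) ab≡a′b′ (n∣m*n a)
    b′∣ab : b′ ∣ a * b
    b′∣ab = subst (b′ ∣_) (sym ab≡a′b′) (n∣m*n a′)

  coprime-*ʳ : ∀ {a b c} → Coprime a b → Coprime a c → Coprime a (b * c)
  coprime-*ʳ a⊥b a⊥c (d∣a , d∣bc) = a⊥c (d∣a , coprime-cancel a⊥b d∣a ∣-refl d∣bc)

  coprime-^ʳ : ∀ {a b} → Coprime a b → ∀ k → Coprime a (b ^ k)
  coprime-^ʳ _   zero    (_ , d∣1) = ∣1⇒≡1 d∣1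
  coprime-^ʳ a⊥b (suc k)           = coprime-*ʳ a⊥b (coprime-^ʳ a⊥b k)

  coprime-^ : ∀ {a b} → Coprime a b → ∀ j k → Coprime (a ^ j) (b ^ k)
  coprime-^ a⊥b j k = coprime-^ʳ (Coprimality.sym (coprime-^ʳ (Coprimality.sym a⊥b) j)) k

  -- σ is supermultiplicative on coprime arguments (in fact multiplicative; ≤ is all we need):
  -- the products of a divisor of m and a divisor of n are distinct divisors of m n.
  σ-supermultiplicative : ∀ {m n} → Coprime m n → σ m * σ n ≤ σ (m * n)
  σ-supermultiplicative {zero}              _   = z≤n
  σ-supermultiplicative {m@(suc _)} {zero}  _   = ≤-trans (≤-reflexive (*-zeroʳ (σ m))) z≤n
  σ-supermultiplicative {m@(suc _)} {n@(suc _)} m⊥n = begin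
    σ m * σ n                                                   ≡⟨ sum-products (divisors m) (divisors n) ⟨
    sum (cartesianProductWith _*_ (divisors m) (divisors n))   ≤⟨ divisor-sum-bound products! product∣mn ⟩
    σ (m * n)                                                   ∎
    where
    products! : Unique (cartesianProductWith _*_ (divisors m) (divisors n))
    products! = products-unique _*_
      (λ a∈ a′∈ b∈ b′∈ → coprime-product-injective m⊥n
         (∈-divisors⁻ m a∈) (∈-divisors⁻ m a′∈) (∈-divisors⁻ n b∈) (∈-divisors⁻ n b′∈))
      (divisors-unique m) (divisors-unique n)
    product∣mn : ∀ {v} → v ∈ cartesianProductWith _*_ (divisors m) (divisors n) → v ∣ m * n
    product∣mn v∈ with a , b , a∈ , b∈ , refl ← ∈-cartesianProductWith⁻ _*_ (divisors m) (divisors n) v∈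
      = *-pres-∣ (∈-divisors⁻ m a∈) (∈-divisors⁻ n b∈)

  -- a σ(b) ≤ σ(a b): multiplying the divisors of b by a gives distinct divisors of a b.
  σ-scale : ∀ a b .{{_ : NonZero a}} .{{_ : NonZero b}} → a * σ b ≤ σ (a * b)
  σ-scale a b = begin
    a * σ b                         ≡⟨ sum-map-* a (divisors b) ⟨
    sum (map (a *_) (divisors b))   ≤⟨ divisor-sum-bound {{m*n≢0 a b}} (map⁺ (*-cancelˡ-≡ _ _ a) (divisors-unique b)) scaled∣ab ⟩
    σ (a * b)                       ∎
    where
    scaled∣ab : ∀ {v} → v ∈ map (a *_) (divisors b) → v ∣ a * b
    scaled∣ab v∈ with e , e∈ , refl ← ∈-map⁻ (a *_) v∈ = *-monoʳ-∣ a (∈-divisors⁻ b e∈)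

  ^-injective : ∀ q → 1 < q → ∀ {i j} → q ^ i ≡ q ^ j → i ≡ j
  ^-injective q 1<q {i} {j} qⁱ≡qʲ with <-cmp i j
  ... | tri< i<j _ _ = contradiction qⁱ≡qʲ (<⇒≢ (^-monoʳ-< q 1<q i<j))
  ... | tri≈ _ i≡j _ = i≡j
  ... | tri> _ _ j<i = contradiction qⁱ≡qʲ (>⇒≢ (^-monoʳ-< q 1<q j<i))

  ^-∣-^ : ∀ q {i j} → i ≤ j → q ^ i ∣ q ^ j
  ^-∣-^ q {i} {j} i≤j = divides (q ^ (j ∸ i)) (begin-equality
    q ^ j                ≡⟨ cong (q ^_) (m∸n+n≡m i≤j) ⟨
    q ^ (j ∸ i + i)      ≡⟨ ^-distribˡ-+-* q (j ∸ i) i ⟩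
    q ^ (j ∸ i) * q ^ i  ∎)

  -- For q > 1 the powers 1, q, …, q^r are distinct divisors of q^r.
  σ-power-bound : ∀ q r → 1 < q → sum (map (q ^_) (upTo (suc r))) ≤ σ (q ^ r)
  σ-power-bound q@(suc _) r 1<q =
    divisor-sum-bound {{m^n≢0 q r}} (map⁺ (^-injective q 1<q) (upTo⁺ (suc r))) power∣qʳ
    where
    power∣qʳ : ∀ {v} → v ∈ map (q ^_) (upTo (suc r)) → v ∣ q ^ r
    power∣qʳ v∈ with i , i∈ , refl ← ∈-map⁻ (q ^_) v∈ = ^-∣-^ q (s≤s⁻¹ (∈-upTo⁻ i∈))

  σ-prime-bound : ∀ q → 1 < q → 1 + q ≤ σ (q ^ 1)
  σ-prime-bound q 1<q = begin
    1 + q            ≡⟨ solve (q ∷ []) ⟩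
    1 + (q * 1 + 0)  ≤⟨ σ-power-bound q 1 1<q ⟩
    σ (q ^ 1)        ∎

  σ-square-bound : ∀ q → 1 < q → 1 + q + q * q ≤ σ (q ^ 2)
  σ-square-bound q 1<q = begin
    1 + q + q * q                    ≡⟨ solve (q ∷ []) ⟩
    1 + (q * 1 + (q * (q * 1) + 0))  ≤⟨ σ-power-bound q 2 1<q ⟩
    σ (q ^ 2)                        ∎

  σ-prime-power-bound : ∀ q j → 1 < q → q ^ j * (1 + q + q * q) ≤ σ (q ^ (2 + j))
  σ-prime-power-bound q j 1<q = begin
    q ^ j * (1 + q + q * q)  ≤⟨ *-monoʳ-≤ (q ^ j) (σ-square-bound q 1<q) ⟩
    q ^ j * σ (q ^ 2)        ≤⟨ σ-scale (q ^ j) (q ^ 2) {{m^n≢0 q j}} {{m^n≢0 q 2}} ⟩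
    σ (q ^ j * q ^ 2)        ≡⟨ cong σ (^-distribˡ-+-* q j 2) ⟨
    σ (q ^ (j + 2))          ≡⟨ cong (σ ∘ (q ^_)) (+-comm j 2) ⟩
    σ (q ^ (2 + j))          ∎
    where
    instance
      q≢0 : NonZero q
      q≢0 = >-nonZero (<⇒≤ 1<q)

  perfect-coprime-bound : ∀ {m n} → Perfect (m * n) → Coprime m n → σ m * σ n ≤ 2 * (m * n)
  perfect-coprime-bound (_ , σmn≡2mn) m⊥n = ≤-trans (σ-supermultiplicative m⊥n) (≤-reflexive σmn≡2mn)

module Elimination where

  open import Data.Nat using (_≤_; _<_; s≤s)
  open import Data.Nat.Properties
  open import Data.Nat.Tactic.RingSolver using (solve)
  open import Data.List using (_∷_; [])
  open import Relation.Binary.PropositionalEquality using (refl)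
  open ≤-Reasoning

  eliminate-σ : ∀ q P S c m .{{_ : NonZero P}} →
                6 * (q * P) ≤ 3 * (q * S) + 5 * P → c * S ≤ 2 * (m * P) →
                6 * q * c ≤ 6 * q * m + 5 * c
  eliminate-σ q P S c m hyp c·S≤2mP = *-cancelʳ-≤ _ _ P (begin
    6 * q * c * P                      ≡⟨ solve (q ∷ P ∷ c ∷ []) ⟩
    c * (6 * (q * P))                  ≤⟨ *-monoʳ-≤ c hyp ⟩
    c * (3 * (q * S) + 5 * P)          ≡⟨ solve (q ∷ P ∷ S ∷ c ∷ []) ⟩
    3 * q * (c * S) + 5 * c * P        ≤⟨ +-monoˡ-≤ (5 * c * P) (*-monoʳ-≤ (3 * q) c·S≤2mP) ⟩
    3 * q * (2 * (m * P)) + 5 * c * P  ≡⟨ solve (q ∷ P ∷ c ∷ m ∷ []) ⟩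
    (6 * q * m + 5 * c) * P            ∎)

  exponent-one-bound : ∀ q → 6 * q * (1 + q) ≤ 6 * q * q ^ 1 + 5 * (1 + q) → q ≤ 5
  exponent-one-bound q ineq = +-cancelʳ-≤ (5 * q + 6 * (q * q)) q 5 (begin
    q + (5 * q + 6 * (q * q))      ≡⟨ solve (q ∷ []) ⟩
    6 * q * (1 + q)                ≤⟨ ineq ⟩
    6 * q * (q * 1) + 5 * (1 + q)  ≡⟨ solve (q ∷ []) ⟩
    5 + (5 * q + 6 * (q * q))      ∎)

  large-exponent-impossible : ∀ q x .{{_ : NonZero x}} → 1 < q →
    6 * q * (x * (1 + q + q * q)) ≤ 6 * q * (q * (q * x)) + 5 * (x * (1 + q + q * q)) → ⊥
  large-exponent-impossible q x 1<q ineq = <-irrefl refl (≤-trans six≤q+q² q+q²≤5)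
    where
    six≤q+q² : 6 ≤ q + q * q
    six≤q+q² = +-mono-≤ 1<q (*-mono-≤ 1<q 1<q)
    q+q²≤5 : q + q * q ≤ 5
    q+q²≤5 = *-cancelʳ-≤ _ _ x (+-cancelʳ-≤ (x * (5 * q + 5 * (q * q) + 6 * (q * (q * q)))) _ _ (begin
      (q + q * q) * x + x * (5 * q + 5 * (q * q) + 6 * (q * (q * q)))  ≡⟨ solve (q ∷ x ∷ []) ⟩
      6 * q * (x * (1 + q + q * q))                                    ≤⟨ ineq ⟩
      6 * q * (q * (q * x)) + 5 * (x * (1 + q + q * q))                ≡⟨ solve (q ∷ x ∷ []) ⟩
      5 * x + x * (5 * q + 5 * (q * q) + 6 * (q * (q * q)))            ∎))

  five-only : ∀ q → 1 < q → q ≤ 5 → q % 4 ≡ 1 → q ≡ 5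
  five-only 5 _ _ _ = refl
  five-only 1 (s≤s ()) _ _
  five-only (suc (suc (suc (suc (suc (suc _)))))) _ (s≤s (s≤s (s≤s (s≤s (s≤s ()))))) _

open DivisorSums using (coprime-^; perfect-coprime-bound; σ-prime-bound; σ-prime-power-bound)
open Elimination using (eliminate-σ; exponent-one-bound; large-exponent-impossible; five-only)

open import Data.Integer using (+_)
open import Data.Rational.Unnormalised using (_≤_; _-_; _/_)

import Data.Nat as ℕ
import Data.Nat.Properties as ℕ
import Data.Integer as ℤ
import Data.Integer.Properties as ℤ
import Data.Integer.Tactic.RingSolver as ℤ-Solver
open import Data.Rational.Unnormalised using (*≤*)
open import Relation.Binary.PropositionalEquality using (refl; trans; cong; cong₂; subst₂; module ≡-Reasoning)

-- The two sides of the inequality 2 - 5/(3q) ≤ S/P after cross-multiplication, each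
-- increased by 5P, as images of natural numbers.
shifted-lhs : ∀ q P → (+ 2 ℤ.* + (3 * q) ℤ.+ ℤ.- (+ 5) ℤ.* + 1) ℤ.* + P ℤ.+ + 5 ℤ.* + P ≡ + (6 * (q * P))
shifted-lhs q P = begin
  (+ 2 ℤ.* + (3 * q) ℤ.+ ℤ.- (+ 5) ℤ.* + 1) ℤ.* + P ℤ.+ + 5 ℤ.* + P
    ≡⟨ cong (λ t → (+ 2 ℤ.* t ℤ.+ ℤ.- (+ 5) ℤ.* + 1) ℤ.* + P ℤ.+ + 5 ℤ.* + P) (ℤ.pos-* 3 q) ⟩
  (+ 2 ℤ.* (+ 3 ℤ.* + q) ℤ.+ ℤ.- (+ 5) ℤ.* + 1) ℤ.* + P ℤ.+ + 5 ℤ.* + P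
    ≡⟨ ring (+ q) (+ P) ⟩
  + 6 ℤ.* (+ q ℤ.* + P)
    ≡⟨ cong (+ 6 ℤ.*_) (ℤ.pos-* q P) ⟨
  + 6 ℤ.* + (q * P)
    ≡⟨ ℤ.pos-* 6 (q * P) ⟨
  + (6 * (q * P))
    ∎
  where
  open ≡-Reasoning
  ring : ∀ Q R → (+ 2 ℤ.* (+ 3 ℤ.* Q) ℤ.+ ℤ.- (+ 5) ℤ.* + 1) ℤ.* R ℤ.+ + 5 ℤ.* R ≡ + 6 ℤ.* (Q ℤ.* R)
  ring = ℤ-Solver.solve-∀

shifted-rhs : ∀ q P S → + S ℤ.* (+ 1 ℤ.* + (3 * q)) ℤ.+ + 5 ℤ.* + P ≡ + (3 * (q * S) + 5 * P)
shifted-rhs q P S = begin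
  + S ℤ.* (+ 1 ℤ.* + (3 * q)) ℤ.+ + 5 ℤ.* + P  ≡⟨ cong (λ t → + S ℤ.* t ℤ.+ + 5 ℤ.* + P) (ℤ.*-identityˡ (+ (3 * q))) ⟩
  + S ℤ.* + (3 * q) ℤ.+ + 5 ℤ.* + P            ≡⟨ cong₂ ℤ._+_ (ℤ.pos-* S (3 * q)) (ℤ.pos-* 5 P) ⟨
  + (S * (3 * q)) ℤ.+ + (5 * P)                ≡⟨ ℤ.pos-+ (S * (3 * q)) (5 * P) ⟨
  + (S * (3 * q) + 5 * P)                      ≡⟨ cong (λ t → + (t + 5 * P)) (trans (ℕ.*-comm S (3 * q)) (ℕ.*-assoc 3 q S)) ⟩
  + (3 * (q * S) + 5 * P)                      ∎
  where
  open ≡-Reasoning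

abundancy-lower-bound : ∀ q P → (+ 2) / 1 - five/3q q ≤ I P → 6 * (q * P) ℕ.≤ 3 * (q * σ P) + 5 * P
abundancy-lower-bound zero      P         _ = ℕ.z≤n
abundancy-lower-bound q@(suc _) zero      _ = ℕ.≤-trans (ℕ.≤-reflexive (cong (6 *_) (ℕ.*-zeroʳ q))) ℕ.z≤n
abundancy-lower-bound q@(suc _) P@(suc _) (*≤* cross-multiplied) =
  ℤ.drop‿+≤+ (subst₂ ℤ._≤_ (shifted-lhs q P) (shifted-rhs q P (σ P)) (ℤ.+-monoˡ-≤ (+ 5 ℤ.* + P) cross-multiplied))

σ-eliminated : ∀ q k n → Perfect (q ^ k * n ^ 2) → Coprime q n → (+ 2) / 1 - five/3q q ≤ I (n ^ 2) →
               ∀ c → c ℕ.≤ σ (q ^ k) → 6 * q * c ℕ.≤ 6 * q * q ^ k + 5 * c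
σ-eliminated q k n perfect@(0<N , _) q⊥n abundant c c≤σqᵏ =
  eliminate-σ q (n ^ 2) (σ (n ^ 2)) c (q ^ k) {{n²≢0}} (abundancy-lower-bound q (n ^ 2) abundant) c·S≤2qᵏP
  where
  n²≢0 : NonZero (n ^ 2)
  n²≢0 = ℕ.m*n≢0⇒n≢0 (q ^ k) {{>-nonZero 0<N}}
  c·S≤2qᵏP : c * σ (n ^ 2) ℕ.≤ 2 * (q ^ k * n ^ 2)
  c·S≤2qᵏP = ℕ.≤-trans (ℕ.*-monoˡ-≤ (σ (n ^ 2)) c≤σqᵏ) (perfect-coprime-bound perfect (coprime-^ q⊥n k 2))

prime⇒1<q : ∀ {q} → Prime q → 1 ℕ.< q
prime⇒1<q {q} q-prime = nonTrivial⇒n>1 q {{prime⇒nonTrivial q-prime}}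

lemma5 : (N q k n : ℕ) → Perfect N → N % 2 ≡ 1 → N ≡ q ^ k * n ^ 2 →
    Prime q → q % 4 ≡ 1 → k % 4 ≡ 1 → Coprime q n →
    (+ 2) / 1 - five/3q q ≤ I (n ^ 2) →
    (k ≡ 1) × (q ≡ 5)
lemma5 N q zero n _ _ _ _ _ () _ _
lemma5 N q (suc zero) n perfect _ refl q-prime q≡1 _ q⊥n abundant = refl , five-only q 1<q q≤5 q≡1
  where
  1<q : 1 ℕ.< q
  1<q = prime⇒1<q q-prime
  q≤5 : q ℕ.≤ 5
  q≤5 = exponent-one-bound q (σ-eliminated q 1 n perfect q⊥n abundant (1 + q) (σ-prime-bound q 1<q))
lemma5 N q (suc (suc j)) n perfect _ refl q-prime _ _ q⊥n abundant =
  ⊥-elim (large-exponent-impossible q (q ^ j) {{qʲ≢0}} 1<q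
           (σ-eliminated q (2 + j) n perfect q⊥n abundant _ (σ-prime-power-bound q j 1<q)))
  where
  1<q : 1 ℕ.< q
  1<q = prime⇒1<q q-prime
  qʲ≢0 : NonZero (q ^ j)
  qʲ≢0 = ℕ.m^n≢0 q j {{prime⇒nonZero q-prime}}
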